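{- Let $\langle\mathbb{A},\Rightarrow\!\!>,\Rightarrow,[\top,\top]\rangle$ be an IBCI-algebra obtained from $\langle A,\rightarrow,\top\rangle$, and write $X\precsim Y$ iff $X\Rightarrow Y=[\top,\top]$. For all $X,Y,Z\in\mathbb{A}$ and all degenerate intervals $X_d=[u,u]$, $Z_d=[w,w]$ ($u,w\in A$): (1) $[\top,\top]\precsim X$ implies $X=[\top,\top]$; (2) $X\precsim Y$ implies $Y\Rightarrow\!\!> Z\precsim X\Rightarrow\!\!> Z$; (3) $X\precsim Y$ implies $Z\Rightarrow\!\!> X\precsim Z\Rightarrow\!\!> Y$; (4) $X\precsim Y$ and $Y\precsim Z$ imply $X\precsim Z$; (5) $X\precsim Y\Rightarrow\!\!> Z_d$ implies $Y\precsim X\Rightarrow\!\!> Z_d$; (6) $X\Rightarrow\!\!> Y\precsim(Z_d\Rightarrow\!\!> X)\Rightarrow\!\!>(Z_d\Rightarrow\!\!> Y)$; (7) $((Y\Rightarrow\!\!> X_d)\Rightarrow\!\!> X_d)\Rightarrow\!\!> X_d=Y\Rightarrow\!\!> X_d$; (8) $X\Rightarrow\!\!> Y\precsim(Y\Rightarrow\!\!> X)\Rightarrow\!\!>[\top,\top]$; (9) $(X\Rightarrow\!\!> Y)\Rightarrow\!\!>[\top,\top]=(X\Rightarrow\!\!>[\top,\top])\Rightarrow\!\!>(Y\Rightarrow\!\!>[\top,\top])$.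
   Context: A BCI-algebra is a structure $\langle A,\rightarrow,\top\rangle$ such that for all $x,y,z\in A$: (C1) $(y\rightarrow z)\rightarrow((z\rightarrow x)\rightarrow(y\rightarrow x))=\top$; (C2) $x\rightarrow((x\rightarrow y)\rightarrow y)=\top$; (C3) $x\rightarrow x=\top$; (C4) $x\rightarrow y=\top$ and $y\rightarrow x=\top$ imply $x=y$; its induced order is $x\preceq y$ iff $x\rightarrow y=\top$. Given such an algebra with $\langle A,\preceq\rangle$ a meet-semilattice and $x\rightarrow(y\wedge z)=(x\rightarrow y)\wedge(x\rightarrow z)$ for all $x,y,z$, let $\mathbb{A}=\{[a,b]:a,b\in A,\ a\preceq b\}$, $\underline{[a,b]}=a$, $\overline{[a,b]}=b$; an interval is degenerate if $\underline X=\overline X$. Define $X\Rightarrow\!\!> Y=[\overline{X}\rightarrow\underline{Y},\ \underline{X}\rightarrow\overline{Y}]$ and $X\Rightarrow Y=[(\underline{X}\rightarrow\underline{Y})\wedge(\overline{X}\rightarrow\overline{Y}),\ \underline{X}\rightarrow\overline{Y}]$; $\langle\mathbb{A},\Rightarrow\!\!>,\Rightarrow,[\top,\top]\rangle$ is the IBCI-algebra. -}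

module Defs where

open import Level using (Level; suc; _⊔_)
open import Relation.Binary.PropositionalEquality using (_≡_)
open import Data.Product using (_×_; _,_; proj₁; proj₂)

record BCIMeet (a : Level) : Set (suc a) where
  infixr 5 _⟶_
  infixr 6 _∧_
  field
    Carrier : Set a
    _⟶_     : Carrier → Carrier → Carrier
    ⊤       : Carrier
    _∧_     : Carrier → Carrier → Carrier

  _≼_ : Carrier → Carrier → Set a
  x ≼ y = (x ⟶ y) ≡ ⊤

  field
    C1 : ∀ x y z → ((y ⟶ z) ⟶ ((z ⟶ x) ⟶ (y ⟶ x))) ≡ ⊤
    C2 : ∀ x y → (x ⟶ ((x ⟶ y) ⟶ y)) ≡ ⊤
    C3 : ∀ x → (x ⟶ x) ≡ ⊤
    C4 : ∀ x y → (x ⟶ y) ≡ ⊤ → (y ⟶ x) ≡ ⊤ → x ≡ y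
    ∧-lb₁  : ∀ x y → (x ∧ y) ≼ x
    ∧-lb₂  : ∀ x y → (x ∧ y) ≼ y
    ∧-glb  : ∀ x y z → z ≼ x → z ≼ y → z ≼ (x ∧ y)
    ⟶-∧    : ∀ x y z → (x ⟶ (y ∧ z)) ≡ ((x ⟶ y) ∧ (x ⟶ z))

module IBCI {a : Level} (B : BCIMeet a) where
  open BCIMeet B public

  -- An interval [a,b] is represented by its pair of endpoints (lower, upper);
  -- membership in 𝔸 is the predicate IsInterval (a ≼ b).
  Pair : Set a
  Pair = Carrier × Carrier

  lo hi : Pair → Carrier
  lo = proj₁
  hi = proj₂

  IsInterval : Pair → Set a
  IsInterval X = lo X ≼ hi X

  deg : Carrier → Pair
  deg u = (u , u)

  𝟙 : Pair
  𝟙 = (⊤ , ⊤)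

  infixr 5 _⇒>_ _⇒_
  _⇒>_ : Pair → Pair → Pair
  X ⇒> Y = ((hi X ⟶ lo Y) , (lo X ⟶ hi Y))

  _⇒_ : Pair → Pair → Pair
  X ⇒ Y = (((lo X ⟶ lo Y) ∧ (hi X ⟶ hi Y)) , (lo X ⟶ hi Y))

  infix 4 _≾_
  _≾_ : Pair → Pair → Set a
  X ≾ Y = (X ⇒ Y) ≡ 𝟙

module Submission where

-- Every clause of the theorem is a statement about endpoints, so
-- the proof reduces the interval algebra to its underlying BCI-algebra.
--   * BCI.  Since a ∧ b = ⊤ iff a = ⊤ and b = ⊤, the relation X ≾ Y holds
--     exactly when lo X ≼ lo Y, hi X ≼ hi Y and lo X ≼ hi Y.
--   * Each of the nine clauses is then a separate lemma: through this
--     characterisation it is a triple (or, for equations, a pair) of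
--     instances of the BCI laws above; the theorem just collects them.

open import Defs
open import Level using (Level)
open import Relation.Binary.PropositionalEquality
  using (_≡_; sym; trans; cong; cong₂; subst; module ≡-Reasoning)
open import Data.Product using (_×_; _,_)

module BCILaws {a : Level} (B : BCIMeet a) where
  open BCIMeet B

  below-⊤⟶ : ∀ x → x ≼ (⊤ ⟶ x)
  below-⊤⟶ x = subst (λ t → (x ⟶ (t ⟶ x)) ≡ ⊤) (C3 x) (C2 x x)

  ⊤⟶-identity : ∀ x → (⊤ ⟶ x) ≡ x
  ⊤⟶-identity x = C4 (⊤ ⟶ x) x t≡⊤ (below-⊤⟶ x)
    where
    t : Carrier
    t = (⊤ ⟶ x) ⟶ x
    ⊤≼t : ⊤ ≼ t
    ⊤≼t = C2 ⊤ x
    t≼⊤ : t ≼ ⊤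
    t≼⊤ = subst (λ s → t ≼ s) ⊤≼t (below-⊤⟶ t)
    t≡⊤ : t ≡ ⊤
    t≡⊤ = C4 t ⊤ t≼⊤ ⊤≼t

  ⊤≼⇒≡⊤ : ∀ {x} → ⊤ ≼ x → x ≡ ⊤
  ⊤≼⇒≡⊤ {x} p = trans (sym (⊤⟶-identity x)) p

  modus-ponens : ∀ {x y} → x ≡ ⊤ → x ≼ y → y ≡ ⊤
  modus-ponens {y = y} x≡⊤ x≼y = ⊤≼⇒≡⊤ (subst (λ t → t ≼ y) x≡⊤ x≼y)

  ⟶-antitone : ∀ {x y z} → x ≼ y → (y ⟶ z) ≼ (x ⟶ z)
  ⟶-antitone {x} {y} {z} x≼y = modus-ponens x≼y (C1 z x y)

  ≼-trans : ∀ {x y z} → x ≼ y → y ≼ z → x ≼ z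
  ≼-trans x≼y y≼z = modus-ponens y≼z (⟶-antitone x≼y)

  ≼-exchange : ∀ {x y z} → x ≼ (y ⟶ z) → y ≼ (x ⟶ z)
  ≼-exchange {y = y} {z} x≼y⟶z = ≼-trans (C2 y z) (⟶-antitone x≼y⟶z)

  prefixing : ∀ p q r → (q ⟶ r) ≼ ((p ⟶ q) ⟶ (p ⟶ r))
  prefixing p q r = ≼-exchange (C1 r p q)

  ⟶-monotone : ∀ {x y z} → x ≼ y → (z ⟶ x) ≼ (z ⟶ y)
  ⟶-monotone {x} {y} {z} x≼y = modus-ponens x≼y (prefixing z x y)

  ⟶-mono : ∀ {x x' y y'} → x' ≼ x → y ≼ y' → (x ⟶ y) ≼ (x' ⟶ y')
  ⟶-mono x'≼x y≼y' = ≼-trans (⟶-monotone y≼y') (⟶-antitone x'≼x)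

  ⟶-exchange : ∀ x y z → (x ⟶ (y ⟶ z)) ≡ (y ⟶ (x ⟶ z))
  ⟶-exchange x y z = C4 _ _ (exchange≼ x y z) (exchange≼ y x z)
    where
    exchange≼ : ∀ x y z → (x ⟶ (y ⟶ z)) ≼ (y ⟶ (x ⟶ z))
    exchange≼ x y z = ≼-exchange (≼-trans (C2 y z) (prefixing x (y ⟶ z) z))

  triple-implication : ∀ a u → (((a ⟶ u) ⟶ u) ⟶ u) ≡ (a ⟶ u)
  triple-implication a u = C4 _ _ (⟶-antitone (C2 a u)) (C2 (a ⟶ u) u)

  ⟶-below-converse⟶⊤ : ∀ a b → (a ⟶ b) ≼ ((b ⟶ a) ⟶ ⊤)
  ⟶-below-converse⟶⊤ a b =
    subst (λ t → (a ⟶ b) ≼ ((b ⟶ a) ⟶ t)) (C3 a) (C1 a a b)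

  ⟶⊤-distrib : ∀ a b → ((a ⟶ b) ⟶ ⊤) ≡ ((a ⟶ ⊤) ⟶ (b ⟶ ⊤))
  ⟶⊤-distrib a b = C4 _ _ (≼-exchange lhs≼) (≼-exchange rhs≼)
    where
    open ≡-Reasoning
    absorb : (b ⟶ (a ⟶ b)) ≡ (a ⟶ ⊤)
    absorb = begin
      b ⟶ (a ⟶ b)  ≡⟨ ⟶-exchange b a b ⟩
      a ⟶ (b ⟶ b)  ≡⟨ cong (a ⟶_) (C3 b) ⟩
      a ⟶ ⊤        ∎
    lhs≼ : (a ⟶ ⊤) ≼ (((a ⟶ b) ⟶ ⊤) ⟶ (b ⟶ ⊤))
    lhs≼ = subst (λ t → t ≼ (((a ⟶ b) ⟶ ⊤) ⟶ (b ⟶ ⊤))) absorb (C1 ⊤ b (a ⟶ b))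
    rhs≼ : (a ⟶ b) ≼ (((a ⟶ ⊤) ⟶ (b ⟶ ⊤)) ⟶ ⊤)
    rhs≼ = ≼-trans (C1 ⊤ a b) (⟶-below-converse⟶⊤ (b ⟶ ⊤) (a ⟶ ⊤))

  ∧≡⊤ : ∀ {x y} → (x ∧ y) ≡ ⊤ → (x ≡ ⊤) × (y ≡ ⊤)
  ∧≡⊤ {x} {y} e =
      ⊤≼⇒≡⊤ (subst (λ t → t ≼ x) e (∧-lb₁ x y))
    , ⊤≼⇒≡⊤ (subst (λ t → t ≼ y) e (∧-lb₂ x y))

  ⊤∧⊤ : (⊤ ∧ ⊤) ≡ ⊤
  ⊤∧⊤ = C4 _ _ (∧-lb₁ ⊤ ⊤) (∧-glb ⊤ ⊤ ⊤ (C3 ⊤) (C3 ⊤))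

module IntervalLaws {a : Level} (B : BCIMeet a) where
  open IBCI B
  open BCILaws B

  EndpointsBelow : Pair → Pair → Set a
  EndpointsBelow X Y = (lo X ≼ lo Y) × (hi X ≼ hi Y) × (lo X ≼ hi Y)

  ≾-intro : ∀ {X Y} → EndpointsBelow X Y → X ≾ Y
  ≾-intro (l , h , lh) = cong₂ _,_ (trans (cong₂ _∧_ l h) ⊤∧⊤) lh

  ≾-elim : ∀ {X Y} → X ≾ Y → EndpointsBelow X Y
  ≾-elim e =
    let l , h = ∧≡⊤ (cong lo e) in l , h , cong hi e

  𝟙-maximal : ∀ X → 𝟙 ≾ X → X ≡ 𝟙
  𝟙-maximal X e =
    let l , h , _ = ≾-elim e in cong₂ _,_ (⊤≼⇒≡⊤ l) (⊤≼⇒≡⊤ h)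

  ⇒>-antitone : ∀ X Y Z → IsInterval Z → X ≾ Y → (Y ⇒> Z) ≾ (X ⇒> Z)
  ⇒>-antitone X Y Z iZ e =
    let l , h , lh = ≾-elim e
    in ≾-intro (⟶-antitone h , ⟶-antitone l , ⟶-mono lh iZ)

  ⇒>-monotone : ∀ X Y Z → IsInterval Z → X ≾ Y → (Z ⇒> X) ≾ (Z ⇒> Y)
  ⇒>-monotone X Y Z iZ e =
    let l , h , lh = ≾-elim e
    in ≾-intro (⟶-monotone l , ⟶-monotone h , ⟶-mono iZ lh)

  ≾-trans : ∀ X Y Z → X ≾ Y → Y ≾ Z → X ≾ Z
  ≾-trans X Y Z e e' =
    let l , h , _ = ≾-elim e ; l' , h' , lh' = ≾-elim e'
    in ≾-intro (≼-trans l l' , ≼-trans h h' , ≼-trans l lh')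

  ≾-exchange : ∀ X Y w → X ≾ (Y ⇒> deg w) → Y ≾ (X ⇒> deg w)
  ≾-exchange X Y w e =
    let l , h , lh = ≾-elim e
    in ≾-intro (≼-exchange h , ≼-exchange l , ≼-exchange lh)

  ⇒>-prefixing : ∀ X Y w → IsInterval X → IsInterval Y →
    (X ⇒> Y) ≾ ((deg w ⇒> X) ⇒> (deg w ⇒> Y))
  ⇒>-prefixing X Y w iX iY =
    ≾-intro ( prefixing w (hi X) (lo Y)
            , prefixing w (lo X) (hi Y)
            , ≼-trans (prefixing w (hi X) (lo Y))
                      (⟶-mono (⟶-monotone iX) (⟶-monotone iY)))

  ⇒>-triple : ∀ Y u → (((Y ⇒> deg u) ⇒> deg u) ⇒> deg u) ≡ (Y ⇒> deg u)
  ⇒>-triple Y u =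
    cong₂ _,_ (triple-implication (hi Y) u) (triple-implication (lo Y) u)

  ⇒>-below-converse⇒>𝟙 : ∀ X Y → IsInterval X → IsInterval Y →
    (X ⇒> Y) ≾ ((Y ⇒> X) ⇒> 𝟙)
  ⇒>-below-converse⇒>𝟙 X Y iX iY =
    ≾-intro ( ⟶-below-converse⟶⊤ (hi X) (lo Y)
            , ⟶-below-converse⟶⊤ (lo X) (hi Y)
            , ≼-trans (⟶-mono iX iY) (⟶-below-converse⟶⊤ (lo X) (hi Y)))

  ⇒>𝟙-distrib : ∀ X Y → ((X ⇒> Y) ⇒> 𝟙) ≡ ((X ⇒> 𝟙) ⇒> (Y ⇒> 𝟙))
  ⇒>𝟙-distrib X Y =
    cong₂ _,_ (⟶⊤-distrib (lo X) (hi Y)) (⟶⊤-distrib (hi X) (lo Y))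

theorem4 : ∀ {a : Level} (B : BCIMeet a) → let open IBCI B in
    ∀ (X Y Z : Pair) → IsInterval X → IsInterval Y → IsInterval Z →
    ∀ (u w : Carrier) →
    ((𝟙 ≾ X → X ≡ 𝟙)
    × (X ≾ Y → (Y ⇒> Z) ≾ (X ⇒> Z))
    × (X ≾ Y → (Z ⇒> X) ≾ (Z ⇒> Y))
    × (X ≾ Y → Y ≾ Z → X ≾ Z)
    × (X ≾ (Y ⇒> deg w) → Y ≾ (X ⇒> deg w))
    × ((X ⇒> Y) ≾ ((deg w ⇒> X) ⇒> (deg w ⇒> Y)))
    × ((((Y ⇒> deg u) ⇒> deg u) ⇒> deg u) ≡ (Y ⇒> deg u))
    × ((X ⇒> Y) ≾ ((Y ⇒> X) ⇒> 𝟙))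
    × (((X ⇒> Y) ⇒> 𝟙) ≡ ((X ⇒> 𝟙) ⇒> (Y ⇒> 𝟙))))
theorem4 B X Y Z iX iY iZ u w =
    𝟙-maximal X
  , ⇒>-antitone X Y Z iZ
  , ⇒>-monotone X Y Z iZ
  , ≾-trans X Y Z
  , ≾-exchange X Y w
  , ⇒>-prefixing X Y w iX iY
  , ⇒>-triple Y u
  , ⇒>-below-converse⇒>𝟙 X Y iX iY
  , ⇒>𝟙-distrib X Y
  where open IntervalLaws B
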